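{- If $G$ is an oriented hypergraph, then $L(G)$ and $L(G^*)$ have the same nonzero eigenvalues.
   Context: An oriented hypergraph $G=(H,\sigma)$ consists of a finite hypergraph $H=(V,E,\mathcal{I})$ with vertex set $V=\{v_1,\dots,v_n\}$, a finite set $E=\{e_1,\dots,e_m\}$ of edges, each edge a (possibly empty) subset of $V$, and incidence set $\mathcal{I}$, together with an incidence orientation $\sigma:\mathcal{I}\to\{+1,-1\}$. Throughout, hypergraphs are simple: $(v,e)\in\mathcal{I}$ if and only if $v\in e$, each such pair occurring once. The degree $d_i$ of $v_i$ is the number of incidences containing $v_i$. For distinct $v_i,v_j\in e$, $\mathrm{sgn}_e(v_i,v_j)=-\sigma(v_i,e)\sigma(v_j,e)$. The adjacency matrix $A(G)=(a_{ij})$ has $a_{ij}=\sum_{e\in E:\, v_i,v_j\in e}\mathrm{sgn}_e(v_i,v_j)$ for $i\neq j$ and $a_{ii}=0$; $D(G)=\mathrm{diag}(d_1,\dots,d_n)$; the Laplacian is $L(G)=D(G)-A(G)$. The incidence dual $G^*=(H^*,\sigma^*)$ is the oriented hypergraph whose vertex set is $E$, whose edge set is $V$ (the edge corresponding to $v$ consists of all $e\in E$ with $(v,e)\in\mathcal{I}$), whose incidences are $\mathcal{I}^*=\{(e,v):(v,e)\in\mathcal{I}\}$, and with orientation $\sigma^*(e,v)=\sigma(v,e)$; its Laplacian $L(G^*)$ is defined by the same formulas applied to $G^*$. -}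

module Defs where

open import Level using (Level; suc; _⊔_)
open import Data.Nat using (ℕ; zero) renaming (suc to sucℕ)
open import Data.Fin using (Fin; _≟_) renaming (zero to fzero; suc to fsuc)
open import Data.Bool using (Bool; true; false; if_then_else_; _∧_)
open import Data.Sign using (Sign) renaming (+ to pos; - to neg)
open import Data.Product using (Σ; ∃; _×_; _,_)
open import Relation.Nullary using (¬_; does)
open import Function using (flip)
open import Function.Bundles using (_⇔_)
open import Algebra.Bundles using (CommutativeRing)

-- Oriented hypergraphs with vertex set Fin n and edge set Fin m.
-- inc v e = true  iff  (v , e) is an incidence (simple: v ∈ e).
-- σ v e is the orientation of the incidence (v , e); its value is
-- irrelevant when inc v e = false.

record OrientedHypergraph (n m : ℕ) : Set where
  field
    inc : Fin n → Fin m → Bool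
    σ   : Fin n → Fin m → Sign

open OrientedHypergraph public

dual : ∀ {n m} → OrientedHypergraph n m → OrientedHypergraph m n
dual G = record { inc = flip (inc G) ; σ = flip (σ G) }

record Field c ℓ : Set (suc (c ⊔ ℓ)) where
  field
    commutativeRing : CommutativeRing c ℓ
  open CommutativeRing commutativeRing public
  field
    0≉1     : ¬ (0# ≈ 1#)
    inverse : ∀ x → ¬ (x ≈ 0#) → ∃ λ y → x * y ≈ 1#

module LinearAlgebra {c ℓ} (F : Field c ℓ) where
  open Field F

  ∑ : ∀ {n} → (Fin n → Carrier) → Carrier
  ∑ {zero}   f = 0#
  ∑ {sucℕ n} f = f fzero + ∑ (λ i → f (fsuc i))

  Vector : ℕ → Set c
  Vector n = Fin n → Carrier

  Matrix : ℕ → Set c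
  Matrix n = Fin n → Fin n → Carrier

  _·_ : ∀ {n} → Matrix n → Vector n → Vector n
  (M · v) i = ∑ (λ j → M i j * v j)

  IsZeroVector : ∀ {n} → Vector n → Set ℓ
  IsZeroVector v = ∀ i → v i ≈ 0#

  IsEigenvector : ∀ {n} → Matrix n → Carrier → Vector n → Set ℓ
  IsEigenvector M μ v = ∀ i → (M · v) i ≈ μ * v i

  IsEigenvalue : ∀ {n} → Matrix n → Carrier → Set (c ⊔ ℓ)
  IsEigenvalue M μ = ∃ λ v → ¬ IsZeroVector v × IsEigenvector M μ v

  LinearlyIndependent : ∀ {n k} → (Fin k → Vector n) → Set (c ⊔ ℓ)
  LinearlyIndependent {k = k} vs =
    ∀ (a : Fin k → Carrier) →
      (∀ i → ∑ (λ j → a j * vs j i) ≈ 0#) → ∀ j → a j ≈ 0#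

  MultiplicityAtLeast : ∀ {n} → Matrix n → Carrier → ℕ → Set (c ⊔ ℓ)
  MultiplicityAtLeast {n} M μ k =
    Σ (Fin k → Vector n) λ vs →
      (∀ j → IsEigenvector M μ (vs j)) × LinearlyIndependent vs

  signF : Sign → Carrier
  signF pos = 1#
  signF neg = - 1#

  module _ {n m : ℕ} (G : OrientedHypergraph n m) where

    degree : Fin n → Carrier
    degree i = ∑ (λ e → if inc G i e then 1# else 0#)

    sgn : Fin m → Fin n → Fin n → Carrier
    sgn e i j = - (signF (σ G i e) * signF (σ G j e))

    adjacency : Matrix n
    adjacency i j =
      if does (i ≟ j) then 0#
      else ∑ (λ e → if inc G i e ∧ inc G j e then sgn e i j else 0#)

    degreeMatrix : Matrix n
    degreeMatrix i j = if does (i ≟ j) then degree i else 0#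

    laplacian : Matrix n
    laplacian i j = degreeMatrix i j - adjacency i j

{-# OPTIONS --safe #-}
-- With H the signed incidence matrix (H v e = σ(v, e) if v ∈ e, else 0) one has
-- L(G) = H Hᵀ, and since the incidence matrix of G* is Hᵀ, also L(G*) = Hᵀ H.
-- For any A : n × m, B : m × n and μ ≠ 0, the map v ↦ B v sends μ-eigenvectors
-- of A B to μ-eigenvectors of B A, and is injective on that eigenspace because
-- A (B v) = μ v; so it preserves nonzeroness and linear independence.  Applying
-- this to (H, Hᵀ) and to (Hᵀ, H) gives both directions.
module Submission where

open import Defs
open import Data.Nat using (ℕ; zero; suc)
open import Data.Fin using (Fin; _≟_) renaming (zero to fzero; suc to fsuc)
open import Data.Bool using (true; false; if_then_else_; _∧_)
open import Data.Sign using () renaming (+ to pos; - to neg)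
open import Data.Product using (_×_; _,_)
open import Function using (_∘_; flip)
open import Function.Bundles using (_⇔_; mk⇔)
open import Function.Construct.Composition using (_⇔-∘_)
open import Function.Construct.Symmetry using (⇔-sym)
open import Relation.Nullary using (¬_; yes; no)
import Relation.Binary.PropositionalEquality as ≡
import Algebra.Properties.Ring as RingProperties
import Algebra.Properties.Semiring.Sum as SemiringSum
import Algebra.Properties.CommutativeSemigroup as CommutativeSemigroupProperties
import Relation.Binary.Reasoning.Setoid as SetoidReasoning

module Matrices {c ℓ} (F : Field c ℓ) where
  open Field F
  open LinearAlgebra F
  open RingProperties ring using (-1*x≈-x)
  open SemiringSum semiring
    using (sum; sum-cong-≋; sum-cong-≗; sum-replicate-zero; *-distribˡ-sum; *-distribʳ-sum)
    renaming (∑-comm to sum-comm)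
  open CommutativeSemigroupProperties *-commutativeSemigroup using (x∙yz≈y∙xz)
  open SetoidReasoning setoid

  ∑≡sum : ∀ {n} (f : Vector n) → ∑ f ≡.≡ sum f
  ∑≡sum {zero}  f = ≡.refl
  ∑≡sum {suc n} f = ≡.cong (f fzero +_) (∑≡sum (f ∘ fsuc))

  ∑≈sum : ∀ {n} (f : Vector n) → ∑ f ≈ sum f
  ∑≈sum f = reflexive (∑≡sum f)

  ∑-cong : ∀ {n} {f g : Vector n} → (∀ i → f i ≈ g i) → ∑ f ≈ ∑ g
  ∑-cong {f = f} {g} f≈g = trans (∑≈sum f) (trans (sum-cong-≋ f≈g) (sym (∑≈sum g)))

  ∑-zero : ∀ n → ∑ {n} (λ _ → 0#) ≈ 0#
  ∑-zero n = trans (∑≈sum {n} (λ _ → 0#)) (sum-replicate-zero n)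

  *-distribˡ-∑ : ∀ {n} x (f : Vector n) → x * ∑ f ≈ ∑ (λ i → x * f i)
  *-distribˡ-∑ x f =
    trans (*-congˡ (∑≈sum f)) (trans (*-distribˡ-sum x f) (sym (∑≈sum (λ i → x * f i))))

  *-distribʳ-∑ : ∀ {n} x (f : Vector n) → ∑ f * x ≈ ∑ (λ i → f i * x)
  *-distribʳ-∑ x f =
    trans (*-congʳ (∑≈sum f)) (trans (*-distribʳ-sum x f) (sym (∑≈sum (λ i → f i * x))))

  -‿distrib-∑ : ∀ {n} (f : Vector n) → - ∑ f ≈ ∑ (λ i → - f i)
  -‿distrib-∑ f = begin
    - ∑ f                    ≈⟨ -1*x≈-x (∑ f) ⟨
    - 1# * ∑ f               ≈⟨ *-distribˡ-∑ (- 1#) f ⟩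
    ∑ (λ i → - 1# * f i)     ≈⟨ ∑-cong (λ i → -1*x≈-x (f i)) ⟩
    ∑ (λ i → - f i)          ∎

  ∑-comm : ∀ {n m} (f : Fin n → Fin m → Carrier) →
           ∑ (λ i → ∑ (f i)) ≈ ∑ (λ j → ∑ (λ i → f i j))
  ∑-comm f = begin
    ∑ (λ i → ∑ (f i))                  ≡⟨ ∑∑≡sumsum f ⟩
    sum (λ i → sum (f i))              ≈⟨ sum-comm f ⟩
    sum (λ j → sum (λ i → f i j))      ≡⟨ ∑∑≡sumsum (flip f) ⟨
    ∑ (λ j → ∑ (λ i → f i j))          ∎
    where
    ∑∑≡sumsum : ∀ {n m} (g : Fin n → Fin m → Carrier) → ∑ (λ i → ∑ (g i)) ≡.≡ sum (λ i → sum (g i))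
    ∑∑≡sumsum g = ≡.trans (∑≡sum (λ i → ∑ (g i))) (sum-cong-≗ (∑≡sum ∘ g))

  ∑-pull-scalar : ∀ {n} μ (f g : Vector n) → ∑ (λ j → f j * (μ * g j)) ≈ μ * ∑ (λ j → f j * g j)
  ∑-pull-scalar μ f g =
    trans (∑-cong (λ j → x∙yz≈y∙xz (f j) μ (g j))) (sym (*-distribˡ-∑ μ (λ j → f j * g j)))

  Mat : ℕ → ℕ → Set c
  Mat n m = Fin n → Fin m → Carrier

  infix 4 _≈ᴹ_
  infixl 7 _⊙_

  _≈ᴹ_ : ∀ {n m} → Mat n m → Mat n m → Set ℓ
  A ≈ᴹ B = ∀ i j → A i j ≈ B i j

  ≈ᴹ-sym : ∀ {n m} {A B : Mat n m} → A ≈ᴹ B → B ≈ᴹ A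
  ≈ᴹ-sym A≈B i j = sym (A≈B i j)

  transpose : ∀ {n m} → Mat n m → Mat m n
  transpose = flip

  _▸_ : ∀ {n m} → Mat n m → Vector m → Vector n
  (A ▸ x) i = ∑ (λ j → A i j * x j)

  _⊙_ : ∀ {n m k} → Mat n m → Mat m k → Mat n k
  (A ⊙ B) i l = ∑ (λ j → A i j * B j l)

  lincomb : ∀ {n k} → (Fin k → Carrier) → (Fin k → Vector n) → Vector n
  lincomb a vs i = ∑ (λ j → a j * vs j i)

  ▸-cong : ∀ {n m} (A : Mat n m) {x y : Vector m} → (∀ j → x j ≈ y j) → ∀ i → (A ▸ x) i ≈ (A ▸ y) i
  ▸-cong A x≈y i = ∑-cong (λ j → *-congˡ (x≈y j))

  ▸-zero : ∀ {n m} (A : Mat n m) {x : Vector m} → IsZeroVector x → IsZeroVector (A ▸ x)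
  ▸-zero {m = m} A x≈0 i = trans (∑-cong (λ j → trans (*-congˡ (x≈0 j)) (zeroʳ (A i j)))) (∑-zero m)

  ▸-assoc : ∀ {n m k} (A : Mat n m) (B : Mat m k) (x : Vector k) i →
            (A ▸ (B ▸ x)) i ≈ ((A ⊙ B) ▸ x) i
  ▸-assoc A B x i = begin
    ∑ (λ j → A i j * ∑ (λ l → B j l * x l))
      ≈⟨ ∑-cong (λ j → *-distribˡ-∑ (A i j) (λ l → B j l * x l)) ⟩
    ∑ (λ j → ∑ (λ l → A i j * (B j l * x l)))
      ≈⟨ ∑-comm (λ j l → A i j * (B j l * x l)) ⟩
    ∑ (λ l → ∑ (λ j → A i j * (B j l * x l)))
      ≈⟨ ∑-cong (λ l → ∑-cong (λ j → sym (*-assoc (A i j) (B j l) (x l)))) ⟩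
    ∑ (λ l → ∑ (λ j → A i j * B j l * x l))
      ≈⟨ ∑-cong (λ l → sym (*-distribʳ-∑ (x l) (λ j → A i j * B j l))) ⟩
    ∑ (λ l → (A ⊙ B) i l * x l)
      ∎

  ▸-lincomb : ∀ {n m k} (A : Mat n m) (a : Fin k → Carrier) (vs : Fin k → Vector m) i →
              (A ▸ lincomb a vs) i ≈ lincomb a (λ j → A ▸ vs j) i
  ▸-lincomb A a vs i = begin
    ∑ (λ l → A i l * ∑ (λ j → a j * vs j l))
      ≈⟨ ∑-cong (λ l → *-distribˡ-∑ (A i l) (λ j → a j * vs j l)) ⟩
    ∑ (λ l → ∑ (λ j → A i l * (a j * vs j l)))
      ≈⟨ ∑-comm (λ l j → A i l * (a j * vs j l)) ⟩
    ∑ (λ j → ∑ (λ l → A i l * (a j * vs j l)))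
      ≈⟨ ∑-cong (λ j → ∑-pull-scalar (a j) (A i) (vs j)) ⟩
    ∑ (λ j → a j * (A ▸ vs j) i)
      ∎

  IsEigenvector-resp : ∀ {n} {M N : Matrix n} {μ v} → M ≈ᴹ N → IsEigenvector M μ v → IsEigenvector N μ v
  IsEigenvector-resp M≈N ev i = trans (∑-cong (λ j → *-congʳ (sym (M≈N i j)))) (ev i)

  IsEigenvector-lincomb : ∀ {n k} {M : Matrix n} {μ} (a : Fin k → Carrier) {vs : Fin k → Vector n} →
                          (∀ j → IsEigenvector M μ (vs j)) → IsEigenvector M μ (lincomb a vs)
  IsEigenvector-lincomb {M = M} {μ} a {vs} evs i = begin
    (M ▸ lincomb a vs) i                 ≈⟨ ▸-lincomb M a vs i ⟩
    ∑ (λ j → a j * (M ▸ vs j) i)         ≈⟨ ∑-cong (λ j → *-congˡ (evs j i)) ⟩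
    ∑ (λ j → a j * (μ * vs j i))         ≈⟨ ∑-pull-scalar μ a (λ j → vs j i) ⟩
    μ * lincomb a vs i                   ∎

  *-cancelˡ-≈0 : ∀ {μ x} → ¬ (μ ≈ 0#) → μ * x ≈ 0# → x ≈ 0#
  *-cancelˡ-≈0 {μ} {x} μ≉0 μx≈0 with inverse μ μ≉0
  ... | μ⁻¹ , μμ⁻¹≈1 = begin
    x                ≈⟨ *-identityˡ x ⟨
    1# * x           ≈⟨ *-congʳ μμ⁻¹≈1 ⟨
    μ * μ⁻¹ * x      ≈⟨ *-congʳ (*-comm μ μ⁻¹) ⟩
    μ⁻¹ * μ * x      ≈⟨ *-assoc μ⁻¹ μ x ⟩
    μ⁻¹ * (μ * x)    ≈⟨ *-congˡ μx≈0 ⟩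
    μ⁻¹ * 0#         ≈⟨ zeroʳ μ⁻¹ ⟩
    0#               ∎

  module _ {n m} (A : Mat n m) (B : Mat m n) {μ : Carrier} where

    IsEigenvector-⊙-swap : ∀ {v} → IsEigenvector (A ⊙ B) μ v → IsEigenvector (B ⊙ A) μ (B ▸ v)
    IsEigenvector-⊙-swap {v} ev e = begin
      ((B ⊙ A) ▸ (B ▸ v)) e      ≈⟨ ▸-assoc B A (B ▸ v) e ⟨
      (B ▸ (A ▸ (B ▸ v))) e      ≈⟨ ▸-cong B (λ i → trans (▸-assoc A B v i) (ev i)) e ⟩
      (B ▸ (λ i → μ * v i)) e    ≈⟨ ∑-pull-scalar μ (B e) v ⟩
      μ * (B ▸ v) e              ∎

    ▸-injective-on-eigenspace : ¬ (μ ≈ 0#) → ∀ {v} → IsEigenvector (A ⊙ B) μ v →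
                                IsZeroVector (B ▸ v) → IsZeroVector v
    ▸-injective-on-eigenspace μ≉0 {v} ev Bv≈0 i = *-cancelˡ-≈0 μ≉0 (begin
      μ * v i                    ≈⟨ ev i ⟨
      ((A ⊙ B) ▸ v) i            ≈⟨ ▸-assoc A B v i ⟨
      (A ▸ (B ▸ v)) i            ≈⟨ ▸-zero A Bv≈0 i ⟩
      0#                         ∎)

    IsEigenvalue-⊙-swap : ¬ (μ ≈ 0#) → IsEigenvalue (A ⊙ B) μ → IsEigenvalue (B ⊙ A) μ
    IsEigenvalue-⊙-swap μ≉0 (v , v≉0 , ev) =
      B ▸ v , v≉0 ∘ ▸-injective-on-eigenspace μ≉0 ev , IsEigenvector-⊙-swap ev

    MultiplicityAtLeast-⊙-swap : ¬ (μ ≈ 0#) → ∀ k → MultiplicityAtLeast (A ⊙ B) μ k →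
                                 MultiplicityAtLeast (B ⊙ A) μ k
    MultiplicityAtLeast-⊙-swap μ≉0 k (vs , evs , vs-independent) =
      (λ j → B ▸ vs j) , (λ j → IsEigenvector-⊙-swap (evs j)) , Bvs-independent
      where
      Bvs-independent : LinearlyIndependent (λ j → B ▸ vs j)
      Bvs-independent a Bvs-comb≈0 = vs-independent a
        (▸-injective-on-eigenspace μ≉0 (IsEigenvector-lincomb a evs)
          (λ e → trans (▸-lincomb B a vs e) (Bvs-comb≈0 e)))

  IsEigenvalue-⊙-comm : ∀ {n m} (A : Mat n m) (B : Mat m n) {μ} → ¬ (μ ≈ 0#) →
                        IsEigenvalue (A ⊙ B) μ ⇔ IsEigenvalue (B ⊙ A) μ
  IsEigenvalue-⊙-comm A B μ≉0 = mk⇔ (IsEigenvalue-⊙-swap A B μ≉0) (IsEigenvalue-⊙-swap B A μ≉0)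

  MultiplicityAtLeast-⊙-comm : ∀ {n m} (A : Mat n m) (B : Mat m n) {μ} → ¬ (μ ≈ 0#) → ∀ k →
                               MultiplicityAtLeast (A ⊙ B) μ k ⇔ MultiplicityAtLeast (B ⊙ A) μ k
  MultiplicityAtLeast-⊙-comm A B μ≉0 k =
    mk⇔ (MultiplicityAtLeast-⊙-swap A B μ≉0 k) (MultiplicityAtLeast-⊙-swap B A μ≉0 k)

  module _ {n} {M N : Matrix n} (M≈N : M ≈ᴹ N) {μ : Carrier} where

    IsEigenvalue-cong : IsEigenvalue M μ ⇔ IsEigenvalue N μ
    IsEigenvalue-cong = mk⇔
      (λ (v , v≉0 , ev) → v , v≉0 , IsEigenvector-resp M≈N ev)
      (λ (v , v≉0 , ev) → v , v≉0 , IsEigenvector-resp (≈ᴹ-sym M≈N) ev)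

    MultiplicityAtLeast-cong : ∀ k → MultiplicityAtLeast M μ k ⇔ MultiplicityAtLeast N μ k
    MultiplicityAtLeast-cong k = mk⇔
      (λ (vs , evs , independent) → vs , IsEigenvector-resp M≈N ∘ evs , independent)
      (λ (vs , evs , independent) → vs , IsEigenvector-resp (≈ᴹ-sym M≈N) ∘ evs , independent)

module HypergraphLaplacian {c ℓ} (F : Field c ℓ) where
  open Field F
  open LinearAlgebra F
  open Matrices F
  open RingProperties ring using (-1*x≈-x; -0#≈0#; -‿involutive)
  open SetoidReasoning setoid

  signF-square : ∀ s → signF s * signF s ≈ 1#
  signF-square pos = *-identityˡ 1#
  signF-square neg = trans (-1*x≈-x (- 1#)) (-‿involutive 1#)

  module _ {n m} (G : OrientedHypergraph n m) where

    incidenceMatrix : Mat n m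
    incidenceMatrix v e = if inc G v e then signF (σ G v e) else 0#

    incidence-indicator≈square : ∀ v e →
      (if inc G v e then 1# else 0#) ≈ incidenceMatrix v e * incidenceMatrix v e
    incidence-indicator≈square v e with inc G v e
    ... | true  = sym (signF-square (σ G v e))
    ... | false = sym (zeroˡ 0#)

    -sgn≈incidence-product : ∀ i j e →
      - (if inc G i e ∧ inc G j e then sgn G e i j else 0#) ≈ incidenceMatrix i e * incidenceMatrix j e
    -sgn≈incidence-product i j e with inc G i e | inc G j e
    ... | true  | true  = -‿involutive _
    ... | true  | false = trans -0#≈0# (sym (zeroʳ _))
    ... | false | _     = trans -0#≈0# (sym (zeroˡ _))

    laplacian≈incidence⊙transpose : laplacian G ≈ᴹ incidenceMatrix ⊙ transpose incidenceMatrix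
    laplacian≈incidence⊙transpose i j with i ≟ j
    ... | yes ≡.refl = begin
      degree G i - 0#         ≈⟨ +-congˡ -0#≈0# ⟩
      degree G i + 0#         ≈⟨ +-identityʳ (degree G i) ⟩
      degree G i              ≈⟨ ∑-cong (incidence-indicator≈square i) ⟩
      (incidenceMatrix ⊙ transpose incidenceMatrix) i i ∎
    ... | no _ = begin
      0# - ∑ a                                           ≈⟨ +-identityˡ (- ∑ a) ⟩
      - ∑ a                                              ≈⟨ -‿distrib-∑ a ⟩
      ∑ (λ e → - a e)                                    ≈⟨ ∑-cong (-sgn≈incidence-product i j) ⟩
      (incidenceMatrix ⊙ transpose incidenceMatrix) i j  ∎
      where
      a : Fin m → Carrier
      a e = if inc G i e ∧ inc G j e then sgn G e i j else 0#

corollary4p2 : ∀ {c ℓ} (F : Field c ℓ) {n m : ℕ} (G : OrientedHypergraph n m) →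
    let open Field F
        open LinearAlgebra F
    in ∀ (μ : Carrier) → ¬ (μ ≈ 0#) →
         (IsEigenvalue (laplacian G) μ ⇔ IsEigenvalue (laplacian (dual G)) μ)
         × (∀ (k : ℕ) → MultiplicityAtLeast (laplacian G) μ k ⇔ MultiplicityAtLeast (laplacian (dual G)) μ k)
corollary4p2 F {n} {m} G μ μ≉0 =
    ⇔-sym (IsEigenvalue-cong L*≈HᵀH)
      ⇔-∘ (IsEigenvalue-⊙-comm H Hᵀ μ≉0 ⇔-∘ IsEigenvalue-cong L≈HHᵀ)
  , λ k → ⇔-sym (MultiplicityAtLeast-cong L*≈HᵀH k)
            ⇔-∘ (MultiplicityAtLeast-⊙-comm H Hᵀ μ≉0 k ⇔-∘ MultiplicityAtLeast-cong L≈HHᵀ k)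
  where
  open LinearAlgebra F
  open Matrices F
  open HypergraphLaplacian F

  H : Mat n m
  H = incidenceMatrix G

  Hᵀ : Mat m n
  Hᵀ = transpose H

  L≈HHᵀ : laplacian G ≈ᴹ H ⊙ Hᵀ
  L≈HHᵀ = laplacian≈incidence⊙transpose G

  L*≈HᵀH : laplacian (dual G) ≈ᴹ Hᵀ ⊙ H
  L*≈HᵀH = laplacian≈incidence⊙transpose (dual G)
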